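{- If $s,t\geq 2$, then $o(P_s\,\square\,P_t)=\mathcal{R}$ and $R_{\rm MB}(P_s\,\square\,P_t)=R'_{\rm MB}(P_s\,\square\,P_t)=\dim(P_s\,\square\,P_t)=2$.
   Context: $P_n$ is the path on $n$ vertices and $\square$ denotes the Cartesian product of graphs. A resolving set of $G$ is $W\subseteq V(G)$ such that for all distinct $x,y$ some $z\in W$ has $d(x,z)\neq d(y,z)$; $\dim(G)$ is its minimum size. In the Maker-Breaker resolving game, Resolver and Spoiler alternately select (without skipping) a not-yet-selected vertex; Resolver wins if at some point his vertices form a resolving set, otherwise Spoiler wins. $o(G)=\mathcal{R}$ means Resolver has a winning strategy both when he moves first and when Spoiler moves first. $R_{\rm MB}(G)$ (resp. $R'_{\rm MB}(G)$) is the minimum number of moves Resolver needs to win when he (resp. Spoiler) moves first ($\infty$ if no winning strategy). -}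

module Defs where

open import Data.Nat using (ℕ; zero; suc; _<_; _≤_)
open import Data.Fin using (Fin; toℕ)
open import Data.Product using (Σ; _×_; _,_)
open import Data.Sum using (_⊎_)
open import Data.Empty using (⊥)
open import Data.List using (List; []; _∷_; length)
open import Data.List.Membership.Propositional using (_∈_; _∉_)
open import Data.List.Relation.Unary.Unique.Propositional using (Unique)
open import Relation.Nullary using (¬_)
open import Relation.Binary.PropositionalEquality using (_≡_; _≢_)

record Graph : Set₁ where
  field
    V   : Set
    Adj : V → V → Set
open Graph public

P : ℕ → Graph
V   (P n) = Fin n
Adj (P n) i j = (toℕ j ≡ suc (toℕ i)) ⊎ (toℕ i ≡ suc (toℕ j))

_□_ : Graph → Graph → Graph
V   (G □ H) = V G × V H
Adj (G □ H) (g , h) (g' , h') = (g ≡ g' × Adj H h h') ⊎ (h ≡ h' × Adj G g g')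

module _ (G : Graph) where

  data Walk : V G → V G → ℕ → Set where
    here : ∀ {x} → Walk x x zero
    step : ∀ {x y z k} → Adj G x y → Walk y z k → Walk x z (suc k)

  Dist : V G → V G → ℕ → Set
  Dist x y d = Walk x y d × (∀ m → m < d → ¬ Walk x y m)

  Resolving : List (V G) → Set
  Resolving W = ∀ x y → x ≢ y →
    Σ (V G) λ z → z ∈ W × Σ ℕ λ a → Σ ℕ λ b → Dist x z a × Dist y z b × a ≢ b

  MetricDimIs : ℕ → Set
  MetricDimIs k = (Σ (List (V G)) λ W → Unique W × length W ≡ k × Resolving W)
                × (∀ W → Unique W → length W < k → ¬ Resolving W)

  Free : List (V G) → List (V G) → V G → Set
  Free R S v = v ∉ R × v ∉ S

  -- RTurn k R S : Resolver to move, R/S already selected; Resolver can force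
  --   a win using at most k further moves of his own.
  -- STurn k R S : same, Spoiler to move.
  -- Resolver wins as soon as his set is resolving; if the board is full
  -- and his set is not resolving, Spoiler wins.
  RTurn : ℕ → List (V G) → List (V G) → Set
  STurn : ℕ → List (V G) → List (V G) → Set
  RTurn zero    R S = Resolving R
  RTurn (suc k) R S = Resolving R ⊎ Σ (V G) λ v → Free R S v × STurn k (v ∷ R) S
  STurn k R S = Resolving R ⊎
    ((Σ (V G) λ u → Free R S u) × (∀ u → Free R S u → RTurn k R (u ∷ S)))

  -- o(G) = 𝓡 : Resolver wins whether he moves first or second
  OutcomeR : Set
  OutcomeR = (Σ ℕ λ k → RTurn k [] []) × (Σ ℕ λ k → STurn k [] [])

  RMBIs : ℕ → Set
  RMBIs k = RTurn k [] [] × (∀ m → m < k → ¬ RTurn m [] [])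

  R'MBIs : ℕ → Set
  R'MBIs k = STurn k [] [] × (∀ m → m < k → ¬ STurn m [] [])

module Submission where

-- In the Maker–Breaker game one Resolver
--    move never suffices when no set of size < 2 resolves, while Resolver
--    wins in two moves as soon as he can claim a vertex v leaving him two
--    distinct free completions n₁, n₂ of v to a resolving set (Spoiler can
--    block only one of them).
--  * For the grid: the distance is the Manhattan distance; two corners
--    sharing a side resolve the grid (the distances to the ends of a side
--    determine both coordinates); no single vertex resolves, as it cannot
--    tell apart two of its neighbours.
-- Resolver then claims a corner v whose two side-neighbouring corners are
-- still free; whether he moves first or second such a corner exists, so
-- all four invariants equal 2.

open import Defs
open import Data.Bool using (Bool; true; false; not)
open import Data.Nat using (ℕ; zero; suc; _≤_; _<_; _+_; _*_; _∸_; ∣_-_∣; z≤n; s≤s; _≟_)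
open import Data.Nat.Properties
open import Data.Nat.Solver using (module +-*-Solver)
open import Data.Fin using (Fin; toℕ; fromℕ; inject₁) renaming (zero to fz; suc to fs)
open import Data.Fin.Properties using (toℕ-injective; toℕ-fromℕ; toℕ-inject₁; toℕ≤pred[n]) renaming (_≟_ to _≟ᶠ_)
open import Data.Product using (Σ; _×_; _,_; proj₁; proj₂)
open import Data.Product.Properties using (≡-dec)
open import Data.Sum using (inj₁; inj₂)
open import Data.Empty using (⊥-elim)
open import Data.List using (List; []; _∷_; length)
open import Data.List.Relation.Unary.Any using (here; there)
open import Data.List.Relation.Unary.All using ([]; _∷_)
open import Data.List.Relation.Unary.AllPairs using ([]; _∷_)
open import Data.List.Membership.Propositional using (_∉_)
open import Relation.Nullary using (¬_; yes; no)
open import Relation.Binary.Definitions using (DecidableEquality; tri<; tri≈; tri>)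
open import Relation.Binary.PropositionalEquality
open ≡-Reasoning

∉-∷ : ∀ {A : Set} {a b : A} {xs : List A} → a ≢ b → a ∉ xs → a ∉ b ∷ xs
∉-∷ a≢b _    (here a≡b) = a≢b a≡b
∉-∷ _   a∉xs (there a∈xs) = a∉xs a∈xs

module _ {G : Graph} where

  walk-zero : ∀ {x y} → Walk G x y 0 → x ≡ y
  walk-zero here = refl

  _++ʷ_ : ∀ {x y z a b} → Walk G x y a → Walk G y z b → Walk G x z (a + b)
  here       ++ʷ w′ = w′
  (step e w) ++ʷ w′ = step e (w ++ʷ w′)

  snoc : ∀ {x y z k} → Walk G x y k → Adj G y z → Walk G x z (suc k)
  snoc here       e = step e here
  snoc (step e′ w) e = step e′ (snoc w e)

  dist-unique : ∀ {x z a b} → Dist G x z a → Dist G x z b → a ≡ b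
  dist-unique {a = a} {b} (wa , a-min) (wb , b-min) with <-cmp a b
  ... | tri< a<b _ _ = ⊥-elim (b-min a a<b wa)
  ... | tri≈ _ a≡b _ = a≡b
  ... | tri> _ _ b<a = ⊥-elim (a-min b b<a wb)

  dist-adj : ∀ {x z} → x ≢ z → Adj G x z → Dist G x z 1
  dist-adj x≢z e = step e here , λ { zero _ w → x≢z (walk-zero w) ; (suc m) (s≤s ()) _ }

  empty-not-resolving : ∀ {x y} → x ≢ y → ¬ Resolving G []
  empty-not-resolving x≢y r with r _ _ x≢y
  ... | _ , () , _

  singleton-not-resolving : ∀ {v x y} → x ≢ y → x ≢ v → y ≢ v → Adj G x v → Adj G y v →
    ¬ Resolving G (v ∷ [])
  singleton-not-resolving x≢y x≢v y≢v xv yv r with r _ _ x≢y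
  ... | _ , here refl , _ , _ , dx , dy , a≢b =
    a≢b (trans (dist-unique dx (dist-adj x≢v xv)) (sym (dist-unique dy (dist-adj y≢v yv))))

  pair-resolving : (δ : V G → V G → ℕ) → (∀ x z → Dist G x z (δ x z)) → ∀ z₀ z₁ →
    (∀ x y → δ x z₀ ≡ δ y z₀ → δ x z₁ ≡ δ y z₁ → x ≡ y) → Resolving G (z₀ ∷ z₁ ∷ [])
  pair-resolving δ dist z₀ z₁ determined x y x≢y with δ x z₀ ≟ δ y z₀ | δ x z₁ ≟ δ y z₁
  ... | no ne  | _     = z₀ , here refl , δ x z₀ , δ y z₀ , dist x z₀ , dist y z₀ , ne
  ... | yes _  | no ne = z₁ , there (here refl) , δ x z₁ , δ y z₁ , dist x z₁ , dist y z₁ , ne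
  ... | yes e₀ | yes e₁ = ⊥-elim (x≢y (determined x y e₀ e₁))

module Game (G : Graph) where

  -- Resolver wins with one more move if two distinct free vertices each
  -- complete his set to a resolving one: Spoiler can take only one of them.
  two-threats : DecidableEquality (V G) → ∀ {R S} n₁ n₂ → n₁ ≢ n₂ →
    Free G R S n₁ → Free G R S n₂ → Resolving G (n₁ ∷ R) → Resolving G (n₂ ∷ R) → STurn G 1 R S
  two-threats _≟ᵥ_ {R} {S} n₁ n₂ n₁≢n₂ (n₁∉R , n₁∉S) (n₂∉R , n₂∉S) r₁ r₂ =
    inj₂ ((n₁ , n₁∉R , n₁∉S) , reply)
    where
    reply : ∀ u → Free G R S u → RTurn G 1 R (u ∷ S)
    reply u _ with n₁ ≟ᵥ u
    ... | no n₁≢u  = inj₂ (n₁ , (n₁∉R , ∉-∷ n₁≢u n₁∉S) , inj₁ r₁)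
    ... | yes refl = inj₂ (n₂ , (n₂∉R , ∉-∷ (λ n₂≡n₁ → n₁≢n₂ (sym n₂≡n₁)) n₂∉S) , inj₁ r₂)

  claim-with-two-threats : DecidableEquality (V G) → ∀ {R S} v n₁ n₂ →
    Free G R S v → n₁ ≢ v → n₂ ≢ v → n₁ ≢ n₂ → Free G R S n₁ → Free G R S n₂ →
    Resolving G (n₁ ∷ v ∷ R) → Resolving G (n₂ ∷ v ∷ R) → RTurn G 2 R S
  claim-with-two-threats _≟ᵥ_ v n₁ n₂ free-v n₁≢v n₂≢v n₁≢n₂ (n₁∉R , n₁∉S) (n₂∉R , n₂∉S) r₁ r₂ =
    inj₂ (v , free-v , two-threats _≟ᵥ_ n₁ n₂ n₁≢n₂ (∉-∷ n₁≢v n₁∉R , n₁∉S) (∉-∷ n₂≢v n₂∉R , n₂∉S) r₁ r₂)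

  module NoSmallResolvingSet (no-empty : ¬ Resolving G [])
                             (no-singleton : ∀ v → ¬ Resolving G (v ∷ [])) where

    small-not-resolving : ∀ W → length W < 2 → ¬ Resolving G W
    small-not-resolving []          _ = no-empty
    small-not-resolving (v ∷ [])    _ = no-singleton v
    small-not-resolving (_ ∷ _ ∷ _) (s≤s (s≤s ()))

    -- After a single own move Resolver holds at most one vertex.
    one-move-not-enough : ∀ {S} → ¬ RTurn G 1 [] S
    one-move-not-enough (inj₁ r)                                = no-empty r
    one-move-not-enough (inj₂ (v , _ , inj₁ r))                 = no-singleton v r
    one-move-not-enough (inj₂ (v , _ , inj₂ ((u , free) , reply))) = no-singleton v (reply u free)

    resolver-first-needs-two : ∀ m → m < 2 → ¬ RTurn G m [] []
    resolver-first-needs-two zero          _   = no-empty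
    resolver-first-needs-two (suc zero)    _   = one-move-not-enough
    resolver-first-needs-two (suc (suc _)) (s≤s (s≤s ()))

    spoiler-first-needs-two : ∀ m → m < 2 → ¬ STurn G m [] []
    spoiler-first-needs-two zero       _ (inj₁ r)                  = no-empty r
    spoiler-first-needs-two zero       _ (inj₂ ((u , free) , reply)) = no-empty (reply u free)
    spoiler-first-needs-two (suc zero) _ (inj₁ r)                  = no-empty r
    spoiler-first-needs-two (suc zero) _ (inj₂ ((u , free) , reply)) = one-move-not-enough (reply u free)
    spoiler-first-needs-two (suc (suc _)) (s≤s (s≤s ()))

    all-invariants-two : ∀ z₀ z₁ → z₀ ≢ z₁ → Resolving G (z₀ ∷ z₁ ∷ []) →
      RTurn G 2 [] [] → STurn G 2 [] [] →
      OutcomeR G × RMBIs G 2 × R'MBIs G 2 × MetricDimIs G 2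
    all-invariants-two z₀ z₁ z₀≢z₁ r first second =
        ((2 , first) , (2 , second))
      , (first , resolver-first-needs-two)
      , (second , spoiler-first-needs-two)
      , ((z₀ ∷ z₁ ∷ []) , ((z₀≢z₁ ∷ []) ∷ [] ∷ []) , refl , r)
      , λ W _ → small-not-resolving W

path-adj-sym : ∀ {n} {i j : Fin n} → Adj (P n) i j → Adj (P n) j i
path-adj-sym (inj₁ e) = inj₂ e
path-adj-sym (inj₂ e) = inj₁ e

path-adj-distinct : ∀ {n} {i j : Fin n} → Adj (P n) i j → i ≢ j
path-adj-distinct (inj₁ e) refl = 1+n≢n (sym e)
path-adj-distinct (inj₂ e) refl = 1+n≢n (sym e)

path-adj-gap : ∀ {n} {i j : Fin n} → Adj (P n) i j → ∣ toℕ i - toℕ j ∣ ≡ 1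
path-adj-gap {i = i} (inj₁ e) = trans (cong ∣ toℕ i -_∣ e) (∣m-1+m∣≡1 (toℕ i))
  where
  ∣m-1+m∣≡1 : ∀ m → ∣ m - suc m ∣ ≡ 1
  ∣m-1+m∣≡1 m = trans (cong ∣ m -_∣ (+-comm 1 m)) (∣m-m+n∣≡n m 1)
path-adj-gap {i = i} {j} (inj₂ e) = trans (∣-∣-comm (toℕ i) (toℕ j)) (path-adj-gap {i = j} (inj₁ e))

path-reverse : ∀ {n} {i j : Fin n} {k} → Walk (P n) i j k → Walk (P n) j i k
path-reverse here       = here
path-reverse (step e w) = snoc (path-reverse w) (path-adj-sym e)

shift : ∀ {n} {i j : Fin n} {k} → Walk (P n) i j k → Walk (P (suc n)) (fs i) (fs j) k
shift here                = here
shift (step (inj₁ e) w) = step (inj₁ (cong suc e)) (shift w)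
shift (step (inj₂ e) w) = step (inj₂ (cong suc e)) (shift w)

walk-from-start : ∀ {n} (j : Fin (suc n)) → Walk (P (suc n)) fz j (toℕ j)
walk-from-start fz = here
walk-from-start {suc n} (fs j) = step {y = fs fz} (inj₁ refl) (shift (walk-from-start j))

path-walk : ∀ {n} (i j : Fin n) → Walk (P n) i j ∣ toℕ i - toℕ j ∣
path-walk fz     fz     = here
path-walk fz     (fs j) = walk-from-start (fs j)
path-walk (fs i) fz     = path-reverse (walk-from-start (fs i))
path-walk (fs i) (fs j) = shift (path-walk i j)

lift₁ : ∀ {G H : Graph} {g g′ : V G} {h : V H} {k} → Walk G g g′ k → Walk (G □ H) (g , h) (g′ , h) k
lift₁ here       = here
lift₁ (step e w) = step (inj₂ (refl , e)) (lift₁ w)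

lift₂ : ∀ {G H : Graph} {g : V G} {h h′ : V H} {k} → Walk H h h′ k → Walk (G □ H) (g , h) (g , h′) k
lift₂ here       = here
lift₂ (step e w) = step (inj₁ (refl , e)) (lift₂ w)

manhattan : ∀ {s t} → V (P s □ P t) → V (P s □ P t) → ℕ
manhattan (i , j) (a , b) = ∣ toℕ i - toℕ a ∣ + ∣ toℕ j - toℕ b ∣

path-step : ∀ {n} {k k′ : Fin n} → Adj (P n) k k′ → ∀ c → ∣ toℕ k - c ∣ ≤ suc ∣ toℕ k′ - c ∣
path-step {k = k} {k′} e c =
  subst (λ g → ∣ toℕ k - c ∣ ≤ g + ∣ toℕ k′ - c ∣) (path-adj-gap e) (∣-∣-triangle (toℕ k) (toℕ k′) c)

manhattan-step : ∀ {s t} {x y : V (P s □ P t)} (z : V (P s □ P t)) → Adj (P s □ P t) x y →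
  manhattan x z ≤ suc (manhattan y z)
manhattan-step {x = i , _} (a , b) (inj₁ (refl , e)) =
  ≤-trans (+-monoʳ-≤ ∣ toℕ i - toℕ a ∣ (path-step e (toℕ b))) (≤-reflexive (+-suc _ _))
manhattan-step {x = _ , j} (a , b) (inj₂ (refl , e)) =
  +-monoˡ-≤ ∣ toℕ j - toℕ b ∣ (path-step e (toℕ a))

manhattan-≤-walk : ∀ {s t} {x z : V (P s □ P t)} {k} → Walk (P s □ P t) x z k → manhattan x z ≤ k
manhattan-≤-walk {x = i , j} here =
  ≤-reflexive (cong₂ _+_ (∣n-n∣≡0 (toℕ i)) (∣n-n∣≡0 (toℕ j)))
manhattan-≤-walk {z = z} (step e w) = ≤-trans (manhattan-step z e) (s≤s (manhattan-≤-walk w))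

grid-dist : ∀ {s t} (x z : V (P s □ P t)) → Dist (P s □ P t) x z (manhattan x z)
grid-dist (i , j) (a , b) =
  lift₁ (path-walk i a) ++ʷ lift₂ (path-walk j b) , λ m m<d w → <⇒≱ m<d (manhattan-≤-walk w)

end : ∀ n → Bool → Fin (suc n)
end n false = fz
end n true  = fromℕ n

ends-differ : ∀ n a → end (suc n) (not a) ≢ end (suc n) a
ends-differ n false ()
ends-differ n true  ()

end-avoiding : ∀ n (i : Fin (suc (suc n))) → Σ Bool λ a → end (suc n) a ≢ i
end-avoiding n fz     = true  , λ ()
end-avoiding n (fs i) = false , λ ()

neighbour : ∀ {n} → Fin (suc (suc n)) → Fin (suc (suc n))
neighbour fz     = fs fz
neighbour (fs k) = inject₁ k

neighbour-adj : ∀ {n} (a : Fin (suc (suc n))) → Adj (P (suc (suc n))) (neighbour a) a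
neighbour-adj fz     = inj₂ refl
neighbour-adj (fs k) = inj₁ (cong suc (sym (toℕ-inject₁ k)))

ends-span : ∀ n a (i : Fin (suc n)) →
  ∣ toℕ i - toℕ (end n (not a)) ∣ + ∣ toℕ i - toℕ (end n a) ∣ ≡ n
ends-span n true  i = begin
  ∣ toℕ i - 0 ∣ + ∣ toℕ i - toℕ (fromℕ n) ∣
    ≡⟨ cong₂ _+_ (∣-∣-identityʳ (toℕ i)) (cong ∣ toℕ i -_∣ (toℕ-fromℕ n)) ⟩
  toℕ i + ∣ toℕ i - n ∣ ≡⟨ cong (toℕ i +_) (m≤n⇒∣m-n∣≡n∸m (toℕ≤pred[n] i)) ⟩
  toℕ i + (n ∸ toℕ i)   ≡⟨ m+[n∸m]≡n (toℕ≤pred[n] i) ⟩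
  n                     ∎
ends-span n false i =
  trans (+-comm ∣ toℕ i - toℕ (fromℕ n) ∣ ∣ toℕ i - 0 ∣) (ends-span n true i)

end-determines : ∀ n a (i i′ : Fin (suc n)) →
  ∣ toℕ i - toℕ (end n a) ∣ ≡ ∣ toℕ i′ - toℕ (end n a) ∣ → i ≡ i′
end-determines n false i i′ e =
  toℕ-injective (trans (sym (∣-∣-identityʳ _)) (trans e (∣-∣-identityʳ _)))
end-determines n true i i′ e = end-determines n false i i′
  (+-cancelʳ-≡ _ _ _ (trans (ends-span n true i) (trans (sym (ends-span n true i′)) (cong (_ +_) (sym e)))))

balanced-offsets : ∀ f₁ g₁ c₁ f₂ g₂ c₂ → f₁ + g₁ ≡ f₂ + g₂ →
  f₁ + c₁ ≡ f₂ + c₂ → g₁ + c₁ ≡ g₂ + c₂ → f₁ ≡ f₂ × c₁ ≡ c₂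
balanced-offsets f₁ g₁ c₁ f₂ g₂ c₂ sums ef eg = f₁≡f₂ , c₁≡c₂
  where
  open +-*-Solver using (solve; _:+_; _:*_; _:=_; con)
  regroup : ∀ f g c → (f + c) + (g + c) ≡ (f + g) + 2 * c
  regroup = solve 3 (λ f g c → (f :+ c) :+ (g :+ c) := (f :+ g) :+ (con 2 :* c)) refl
  c₁≡c₂ : c₁ ≡ c₂
  c₁≡c₂ = *-cancelˡ-≡ c₁ c₂ 2 (+-cancelˡ-≡ (f₂ + g₂) _ _ (begin
    (f₂ + g₂) + 2 * c₁ ≡⟨ cong (_+ 2 * c₁) (sym sums) ⟩
    (f₁ + g₁) + 2 * c₁ ≡⟨ sym (regroup f₁ g₁ c₁) ⟩
    (f₁ + c₁) + (g₁ + c₁) ≡⟨ cong₂ _+_ ef eg ⟩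
    (f₂ + c₂) + (g₂ + c₂) ≡⟨ regroup f₂ g₂ c₂ ⟩
    (f₂ + g₂) + 2 * c₂ ∎))
  f₁≡f₂ : f₁ ≡ f₂
  f₁≡f₂ = +-cancelʳ-≡ c₁ f₁ f₂ (trans ef (cong (f₂ +_) (sym c₁≡c₂)))

-- In a grid line through an end b of the other factor, the distances to the
-- two ends of the line determine a vertex: its position along the line from
-- the sum of the two distances being fixed, the other coordinate from b.
line-ends-determine : ∀ {n m} a b (i i′ : Fin (suc n)) (j j′ : Fin (suc m)) →
  ∣ toℕ i - toℕ (end n (not a)) ∣ + ∣ toℕ j - toℕ (end m b) ∣ ≡ ∣ toℕ i′ - toℕ (end n (not a)) ∣ + ∣ toℕ j′ - toℕ (end m b) ∣ →
  ∣ toℕ i - toℕ (end n a) ∣ + ∣ toℕ j - toℕ (end m b) ∣ ≡ ∣ toℕ i′ - toℕ (end n a) ∣ + ∣ toℕ j′ - toℕ (end m b) ∣ →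
  i ≡ i′ × j ≡ j′
line-ends-determine {n} {m} a b i i′ j j′ e₀ e₁
  with balanced-offsets _ _ _ _ _ _ (trans (ends-span n a i) (sym (ends-span n a i′))) e₀ e₁
... | same-distance , same-offset = end-determines n (not a) i i′ same-distance , end-determines m b j j′ same-offset

module GridCorners (s t : ℕ) where

  Grid : Graph
  Grid = P (suc s) □ P (suc t)

  corner : Bool → Bool → V Grid
  corner a b = end s a , end t b

  row-corners-resolve : ∀ a b → Resolving Grid (corner (not a) b ∷ corner a b ∷ [])
  row-corners-resolve a b = pair-resolving manhattan grid-dist _ _ determined
    where
    determined : ∀ x y → manhattan x (corner (not a) b) ≡ manhattan y (corner (not a) b) →
      manhattan x (corner a b) ≡ manhattan y (corner a b) → x ≡ y
    determined (i , j) (i′ , j′) e₀ e₁ with line-ends-determine a b i i′ j j′ e₀ e₁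
    ... | refl , refl = refl

  column-corners-resolve : ∀ a b → Resolving Grid (corner a (not b) ∷ corner a b ∷ [])
  column-corners-resolve a b = pair-resolving manhattan grid-dist _ _ determined
    where
    transposed : ∀ x z → manhattan x z ≡ ∣ toℕ (proj₂ x) - toℕ (proj₂ z) ∣ + ∣ toℕ (proj₁ x) - toℕ (proj₁ z) ∣
    transposed (i , j) (a , b) = +-comm ∣ toℕ i - toℕ a ∣ ∣ toℕ j - toℕ b ∣
    swap-sums : ∀ x y z → manhattan x z ≡ manhattan y z →
      ∣ toℕ (proj₂ x) - toℕ (proj₂ z) ∣ + ∣ toℕ (proj₁ x) - toℕ (proj₁ z) ∣ ≡
      ∣ toℕ (proj₂ y) - toℕ (proj₂ z) ∣ + ∣ toℕ (proj₁ y) - toℕ (proj₁ z) ∣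
    swap-sums x y z e = trans (sym (transposed x z)) (trans e (transposed y z))
    determined : ∀ x y → manhattan x (corner a (not b)) ≡ manhattan y (corner a (not b)) →
      manhattan x (corner a b) ≡ manhattan y (corner a b) → x ≡ y
    determined (i , j) (i′ , j′) e₀ e₁ with line-ends-determine b a j j′ i i′
      (swap-sums (i , j) (i′ , j′) (corner a (not b)) e₀) (swap-sums (i , j) (i′ , j′) (corner a b) e₁)
    ... | refl , refl = refl

module BigGrid (s t : ℕ) where
  open GridCorners (suc s) (suc t)
  open Game Grid

  -- No single vertex (a , b) resolves: its neighbours in the two
  -- coordinate directions are both at distance 1 from it.
  no-singleton : ∀ v → ¬ Resolving Grid (v ∷ [])
  no-singleton (a , b) = singleton-not-resolving
    (λ e → a′≢a (cong proj₁ e)) (λ e → a′≢a (cong proj₁ e)) (λ e → b′≢b (cong proj₂ e))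
    (inj₂ (refl , neighbour-adj a)) (inj₁ (refl , neighbour-adj b))
    where
    a′≢a : neighbour a ≢ a
    a′≢a = path-adj-distinct (neighbour-adj a)
    b′≢b : neighbour b ≢ b
    b′≢b = path-adj-distinct (neighbour-adj b)

  no-empty : ¬ Resolving Grid []
  no-empty = empty-not-resolving {x = corner true false} {corner false false}
    (λ e → ends-differ s false (cong proj₁ e))

  _≟ᵥ_ : DecidableEquality (V Grid)
  _≟ᵥ_ = ≡-dec _≟ᶠ_ _≟ᶠ_

  claim-corner : ∀ {R S} a b → Free Grid R S (corner a b) →
    Free Grid R S (corner (not a) b) → Free Grid R S (corner a (not b)) →
    Resolving Grid (corner (not a) b ∷ corner a b ∷ R) → Resolving Grid (corner a (not b) ∷ corner a b ∷ R) →
    RTurn Grid 2 R S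
  claim-corner a b free free₁ free₂ = claim-with-two-threats _≟ᵥ_ _ _ _ free
    (λ e → ends-differ s a (cong proj₁ e)) (λ e → ends-differ t b (cong proj₂ e))
    (λ e → ends-differ s a (cong proj₁ e)) free₁ free₂

  resolver-first : RTurn Grid 2 [] []
  resolver-first = claim-corner false false ((λ ()) , (λ ())) ((λ ()) , (λ ())) ((λ ()) , (λ ()))
    (row-corners-resolve false false) (column-corners-resolve false false)

  -- Whatever vertex (i , j) Spoiler opens with, Resolver claims the corner
  -- (a , b) with end a ≠ i and end b ≠ j; it and both threatened corners
  -- differ from (i , j).
  spoiler-first : STurn Grid 2 [] []
  spoiler-first = inj₂ ((corner false false , (λ ()) , (λ ())) , respond)
    where
    respond : ∀ u → Free Grid [] [] u → RTurn Grid 2 [] (u ∷ [])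
    respond (i , j) _ with end-avoiding s i | end-avoiding t j
    ... | a , a≢i | b , b≢j = claim-corner a b
      ((λ ()) , ∉-∷ (λ e → a≢i (cong proj₁ e)) (λ ()))
      ((λ ()) , ∉-∷ (λ e → b≢j (cong proj₂ e)) (λ ()))
      ((λ ()) , ∉-∷ (λ e → a≢i (cong proj₁ e)) (λ ()))
      (row-corners-resolve a b) (column-corners-resolve a b)

  open NoSmallResolvingSet no-empty no-singleton

  result : OutcomeR Grid × RMBIs Grid 2 × R'MBIs Grid 2 × MetricDimIs Grid 2
  result = all-invariants-two (corner true false) (corner false false)
    (λ e → ends-differ s false (cong proj₁ e)) (row-corners-resolve false false)
    resolver-first spoiler-first

proposition4p15 : (s t : ℕ) → 2 ≤ s → 2 ≤ t →
    OutcomeR (P s □ P t) × RMBIs (P s □ P t) 2 × R'MBIs (P s □ P t) 2 × MetricDimIs (P s □ P t) 2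
proposition4p15 (suc (suc s)) (suc (suc t)) (s≤s (s≤s z≤n)) (s≤s (s≤s z≤n)) = BigGrid.result s t
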